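{- Let $\mathcal H=(V,E)$ be a connected hypergraph with a ribbon structure, base node $b_0$ and base edge $b_0b_1$ fixed on $\mathrm{Bip}\,\mathcal H$. Let $T$ be a $V$-cut Jaeger tree, $\varepsilon\in T$, and $\varepsilon_1,\varepsilon_2\in C^*(T,\varepsilon)$. If $\varepsilon_1$ has its violet endpoint in the base component of $T-\varepsilon$ and $\varepsilon_2$ has its emerald endpoint in the base component of $T-\varepsilon$, then (i) $\varepsilon_1<_{T,V}\varepsilon_2$, and (ii) $\varepsilon_1\le_{T,V}\varepsilon$.
   Context: $\mathrm{Bip}\,\mathcal H$ is the bipartite graph with color classes $V$ (violet) and $E$ (emerald), $v$ joined to $e$ iff $v\in e$; connected means $\mathrm{Bip}\,\mathcal H$ is connected. A ribbon structure assigns to each node $x$ a cyclic permutation of its incident edges; $xy^+$ is the edge following $xy$ at $x$. Tour of a spanning tree $T$: sequence of pairs (current node, current edge) starting with $(b_0,b_0b_1)$; from $(x,xy)$ go to $(x,xy^+)$ if $xy\notin T$ and to $(y,yx^+)$ if $xy\in T$; stop right before $(b_0,b_0b_1)$ would recur. Each edge $xy$ appears exactly twice, as $(x,xy)$ and $(y,xy)$. A non-edge $xy$ of $T$ is cut at $x$ if $(x,xy)$ precedes $(y,xy)$; $T$ is a $V$-cut Jaeger tree if every non-edge of $T$ is cut at its violet endpoint. For a $V$-cut Jaeger tree $T$, the violet $T$-order $<_{T,V}$ on edges of $\mathrm{Bip}\,\mathcal H$: $ev<_{T,V}e'v'$ ($v,v'\in V$) iff $(v,ev)$ precedes $(v',e'v')$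 in the tour of $T$; $\le_{T,V}$ allows equality. For $\varepsilon\in T$, $C^*(T,\varepsilon)$ is the set of edges of $\mathrm{Bip}\,\mathcal H$ joining the two components of $T-\varepsilon$, and the base component of $T-\varepsilon$ is the component containing $b_0$. -}

module Defs where

open import Data.Nat using (ℕ; zero; suc; _<_; _≤_)
open import Data.Fin using (Fin)
open import Data.Bool using (Bool; true; false; if_then_else_)
open import Data.Sum using (_⊎_; inj₁; inj₂)
open import Data.Product using (Σ; ∃; _×_; _,_; proj₁; proj₂)
open import Data.List using (List; []; _∷_; _++_; [_]; length)
open import Data.List.Relation.Unary.Linked using (Linked)
open import Data.List.Relation.Unary.Unique.Propositional using (Unique)
open import Relation.Binary.PropositionalEquality using (_≡_; _≢_)
open import Relation.Nullary using (¬_)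

-- A hypergraph with violet nodes V = Fin nV and emerald nodes (hyperedges)
-- E = Fin nE; inc v e = true iff v ∈ e.
record Hypergraph : Set where
  field
    nV nE : ℕ
    inc : Fin nV → Fin nE → Bool

iter : {A : Set} → (A → A) → ℕ → A → A
iter f zero a = a
iter f (suc k) a = f (iter f k a)

module _ (H : Hypergraph) where
  open Hypergraph H

  -- nodes of Bip H: violet (inj₁) or emerald (inj₂)
  Node : Set
  Node = Fin nV ⊎ Fin nE

  BEdge : Set
  BEdge = Fin nV × Fin nE

  lift : (Fin nV → Fin nE → Bool) → Node → Node → Bool
  lift R (inj₁ v) (inj₂ e) = R v e
  lift R (inj₂ e) (inj₁ v) = R v e
  lift R (inj₁ _) (inj₁ _) = false
  lift R (inj₂ _) (inj₂ _) = false

  Adj : Node → Node → Set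
  Adj x y = lift inc x y ≡ true

  data Walk (G : Node → Node → Set) : Node → Node → Set where
    here  : ∀ {x} → Walk G x x
    there : ∀ {x y z} → G x y → Walk G y z → Walk G x z

  Connected : Set
  Connected = ∀ x y → Walk Adj x y

  -- a cycle: distinct nodes x ∷ xs (at least 3), consecutive adjacent, closing up
  HasCycle : (Node → Node → Set) → Set
  HasCycle G = Σ Node λ x → Σ (List Node) λ xs →
    (2 ≤ length xs) × Unique (x ∷ xs) × Linked G (x ∷ xs ++ [ x ])

  TAdj : (Fin nV → Fin nE → Bool) → Node → Node → Set
  TAdj T x y = lift T x y ≡ true

  IsSpanningTree : (Fin nV → Fin nE → Bool) → Set
  IsSpanningTree T =
    (∀ v e → T v e ≡ true → inc v e ≡ true) ×
    (∀ x y → Walk (TAdj T) x y) ×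
    ¬ HasCycle (TAdj T)

  -- ribbon structure: ρ x y is the neighbour following y around x (xy⁺ = x (ρ x y));
  -- ρ x restricted to the neighbours of x is a cyclic permutation of them
  -- (it maps neighbours to neighbours and has a single orbit).
  IsRibbon : (Node → Node → Node) → Set
  IsRibbon ρ =
    (∀ x y → Adj x y → Adj x (ρ x y)) ×
    (∀ x y z → Adj x y → Adj x z → ∃ λ k → iter (ρ x) k y ≡ z)

  -- one step of the tour; a state (x , y) means current node x, current edge xy
  step : (Fin nV → Fin nE → Bool) → (Node → Node → Node) → Node × Node → Node × Node
  step T ρ (x , y) = if lift T x y then (y , ρ y x) else (x , ρ x y)

  module Tour (T : Fin nV → Fin nE → Bool) (ρ : Node → Node → Node) (b₀ b₁ : Node) where

    tourAt : ℕ → Node × Node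
    tourAt k = iter (step T ρ) k (b₀ , b₁)

    -- position j lies in the tour: the start state has not recurred at times 1..j
    InTour : ℕ → Set
    InTour j = ∀ k → 1 ≤ k → k ≤ j → tourAt k ≢ (b₀ , b₁)

    Precedes : Node × Node → Node × Node → Set
    Precedes P Q = ∃ λ i → ∃ λ j → i < j × InTour j × tourAt i ≡ P × tourAt j ≡ Q

    -- T is a V-cut Jaeger tree: every non-edge (v , e) of T is cut at v
    IsVCutJaeger : Set
    IsVCutJaeger = IsSpanningTree T ×
      (∀ v e → inc v e ≡ true → T v e ≡ false →
         Precedes (inj₁ v , inj₂ e) (inj₂ e , inj₁ v))

    _<TV_ : BEdge → BEdge → Set
    (v , e) <TV (v' , e') = Precedes (inj₁ v , inj₂ e) (inj₁ v' , inj₂ e')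

    _≤TV_ : BEdge → BEdge → Set
    a ≤TV b = (a ≡ b) ⊎ (a <TV b)

  TMinusAdj : (Fin nV → Fin nE → Bool) → BEdge → Node → Node → Set
  TMinusAdj T (v₀ , e₀) x y =
    TAdj T x y × ¬ ((x ≡ inj₁ v₀) × (y ≡ inj₂ e₀)) × ¬ ((x ≡ inj₂ e₀) × (y ≡ inj₁ v₀))

  -- ε' ∈ C*(T, ε): an edge of Bip H whose endpoints lie in different components of T - ε
  InFundCut : (Fin nV → Fin nE → Bool) → BEdge → BEdge → Set
  InFundCut T ε (v , e) = (inc v e ≡ true) × ¬ Walk (TMinusAdj T ε) (inj₁ v) (inj₂ e)

  InBaseComp : (Fin nV → Fin nE → Bool) → BEdge → Node → Node → Set
  InBaseComp T ε b₀ x = Walk (TMinusAdj T ε) b₀ x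

module Submission where

-- Along the tour, the current node can only move between the two
-- components of T - ε by a step along ε.  An "exit" is a step along ε taken
-- from the base component, an "entry" one taken towards it.  Since ε has
-- exactly one end in the base component, all exits are the same state, and
-- since the tour is injective up to its first return (the ribbon makes the
-- step map injective), there is at most one exit within the tour.
-- A cut edge (v , e) ≠ ε is a non-edge of T, so (v , e) is visited at some
-- time i and (e , v) at a later time j of the tour; when v is in the base
-- component, some exit happens in [i , j).  When e is in the base component,
-- the visit (v , e) happens after the (unique) exit.  Comparing these times
-- gives (i); for (ii) one locates the violet visit of ε itself, which is the
-- exit or, when only eε is in the base component, the entry after time j.

open import Defs
open import Data.Fin using (Fin)
open import Data.Bool using (Bool; true)
open import Data.Sum using (inj₁; inj₂)
open import Data.Product using (_×_; proj₁; proj₂)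
open import Relation.Binary.PropositionalEquality using (_≡_)

open import Data.Nat using (ℕ; zero; suc; _<_; _≤_; _+_; _*_; z≤n; s≤s; _≤?_; _≤′_; ≤′-reflexive; ≤′-step)
open import Data.Nat.Properties
  using (+-suc; *-comm; m≤n+m; ≤-trans; <⇒≤; ≰⇒>; <-≤-trans; ≤-<-trans; <-trans; <-cmp;
         m<n⇒m<1+n; n<1+n; m≤n⇒m<n∨m≡n; m<1+n⇒m<n∨m≡n; m≤n⇒∃[o]m+o≡n; ≤⇒≤′; ≤′⇒≤)
import Data.Fin as Fin
import Data.Fin.Properties as Finₚ
open import Data.Bool using (false)
open import Data.Sum using (_⊎_)
import Data.Sum.Properties as Sumₚ
import Data.Product.Properties as Productₚ
open import Data.Product using (∃; _,_)
open import Data.Empty using (⊥; ⊥-elim)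
open import Relation.Nullary using (¬_; Dec; yes; no)
open import Relation.Nullary.Decidable using (_×-dec_; _⊎-dec_)
open import Relation.Unary using (Decidable)
open import Relation.Binary.PropositionalEquality
  using (refl; sym; trans; cong; cong₂; subst; module ≡-Reasoning)
open import Relation.Binary.Definitions using (DecidableEquality; tri<; tri≈; tri>)

iter-suc : ∀ {A : Set} (f : A → A) n a → iter f (suc n) a ≡ iter f n (f a)
iter-suc f zero    a = refl
iter-suc f (suc n) a = cong f (iter-suc f n a)

iter-+ : ∀ {A : Set} (f : A → A) m n a → iter f (m + n) a ≡ iter f m (iter f n a)
iter-+ f zero    n a = refl
iter-+ f (suc m) n a = cong f (iter-+ f m n a)

iter-period : ∀ {A : Set} (f : A → A) p a → iter f p a ≡ a → ∀ q → iter f (q * p) a ≡ a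
iter-period f p a fixed zero    = refl
iter-period f p a fixed (suc q) = begin
  iter f (p + q * p) a    ≡⟨ iter-+ f p (q * p) a ⟩
  iter f p (iter f (q * p) a) ≡⟨ cong (iter f p) (iter-period f p a fixed q) ⟩
  iter f p a              ≡⟨ fixed ⟩
  a                       ∎
  where open ≡-Reasoning

-- f is injective on periodic points: y = f^N y = f^(N-1) (f y) for a common period N
periodic-injective : ∀ {A : Set} (f : A → A) {y z} m n →
  iter f (suc m) y ≡ y → iter f (suc n) z ≡ z → f y ≡ f z → y ≡ z
periodic-injective f {y} {z} m n py pz fy≡fz = begin
  y                              ≡⟨ sym (iter-period f (suc m) y py (suc n)) ⟩
  iter f (suc k) y               ≡⟨ iter-suc f k y ⟩
  iter f k (f y)                 ≡⟨ cong (iter f k) fy≡fz ⟩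
  iter f k (f z)                 ≡⟨ sym (iter-suc f k z) ⟩
  iter f (suc n * suc m) z       ≡⟨ cong (λ N → iter f N z) (*-comm (suc n) (suc m)) ⟩
  iter f (suc m * suc n) z       ≡⟨ iter-period f (suc n) z pz (suc m) ⟩
  z                              ∎
  where
  open ≡-Reasoning
  k : ℕ
  k = m + n * suc m

module _ {P : ℕ → Set} (P? : Decidable P) where

  firstBelow : ∀ n → (∀ {k} → k < n → ¬ P k) ⊎ (∃ λ q → P q × (∀ {k} → k < q → ¬ P k))
  firstBelow zero = inj₁ λ ()
  firstBelow (suc n) with firstBelow n
  ... | inj₂ least = inj₂ least
  ... | inj₁ none with P? n
  ...   | yes pn = inj₂ (n , pn , none)
  ...   | no ¬pn = inj₁ λ k<1+n → below (m<1+n⇒m<n∨m≡n k<1+n)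
    where
    below : ∀ {k} → k < n ⊎ k ≡ n → ¬ P k
    below (inj₁ k<n)  = none k<n
    below (inj₂ refl) = ¬pn

  leastWitness : ∀ {n} → P n → ∃ λ q → P q × (∀ {k} → k < q → ¬ P k)
  leastWitness {n} pn with firstBelow (suc n)
  ... | inj₁ none  = ⊥-elim (none (n<1+n n) pn)
  ... | inj₂ least = least

module _ (P Q : ℕ → Set) where

  persists : (∀ k → P k → P (suc k) ⊎ Q k) →
    ∀ {i j} → i ≤′ j → P i → P j ⊎ ∃ λ s → i ≤ s × s < j × Q s
  persists move (≤′-reflexive refl) pi = inj₁ pi
  persists move {i} {suc j} (≤′-step i≤′j) pi with persists move i≤′j pi
  ... | inj₂ (s , i≤s , s<j , qs) = inj₂ (s , i≤s , m<n⇒m<1+n s<j , qs)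
  ... | inj₁ pj with move j pj
  ...   | inj₁ pj+1 = inj₁ pj+1
  ...   | inj₂ qj   = inj₂ (j , ≤′⇒≤ i≤′j , n<1+n j , qj)

  recedes : (∀ k → P (suc k) → P k ⊎ Q k) →
    ∀ {i j} → i ≤′ j → P j → P i ⊎ ∃ λ s → i ≤ s × s < j × Q s
  recedes move (≤′-reflexive refl) pj = inj₁ pj
  recedes move {i} {suc j} (≤′-step i≤′j) pj+1 with move j pj+1
  ... | inj₂ qj = inj₂ (j , ≤′⇒≤ i≤′j , n<1+n j , qj)
  ... | inj₁ pj with recedes move i≤′j pj
  ...   | inj₁ pi = inj₁ pi
  ...   | inj₂ (s , i≤s , s<j , qs) = inj₂ (s , i≤s , m<n⇒m<1+n s<j , qs)

module Graph (H : Hypergraph) where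
  open Hypergraph H

  State : Set
  State = Node H × Node H

  lift-sym : ∀ R (x y : Node H) → lift H R x y ≡ lift H R y x
  lift-sym R (inj₁ _) (inj₁ _) = refl
  lift-sym R (inj₁ _) (inj₂ _) = refl
  lift-sym R (inj₂ _) (inj₁ _) = refl
  lift-sym R (inj₂ _) (inj₂ _) = refl

  adj-sym : ∀ {x y} → Adj H x y → Adj H y x
  adj-sym {x} {y} a = trans (lift-sym inc y x) a

  _≟N_ : DecidableEquality (Node H)
  _≟N_ = Sumₚ.≡-dec Fin._≟_ Fin._≟_

  _≟S_ : DecidableEquality State
  _≟S_ = Productₚ.≡-dec _≟N_ _≟N_

  _≟E_ : DecidableEquality (BEdge H)
  _≟E_ = Productₚ.≡-dec Fin._≟_ Fin._≟_

  violetState : BEdge H → State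
  violetState (v , e) = (inj₁ v , inj₂ e)

  violetState-injective : ∀ {a b} → violetState a ≡ violetState b → a ≡ b
  violetState-injective eq = cong₂ _,_ (Sumₚ.inj₁-injective (cong proj₁ eq)) (Sumₚ.inj₂-injective (cong proj₂ eq))

  -- the finitely many states embed into Fin N (needed for the pigeonhole principle)
  stateCount : ℕ
  stateCount = (nV + nE) * (nV + nE)

  encode : State → Fin stateCount
  encode (x , y) = Fin.combine (Fin.join nV nE x) (Fin.join nV nE y)

  encode-injective : ∀ P Q → encode P ≡ encode Q → P ≡ Q
  encode-injective (x , y) (x' , y') eq with Finₚ.combine-injective _ _ _ _ eq
  ... | x≡x' , y≡y' = cong₂ _,_ (join-injective x≡x') (join-injective y≡y')
    where
    join-injective : ∀ {a b} → Fin.join nV nE a ≡ Fin.join nV nE b → a ≡ b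
    join-injective {a} {b} eq' =
      trans (sym (Finₚ.splitAt-join nV nE a))
            (trans (cong (Fin.splitAt nV) eq') (Finₚ.splitAt-join nV nE b))

  module Walks (G : Node H → Node H → Set) (G-sym : ∀ {x y} → G x y → G y x) where

    snoc : ∀ {a b c} → Walk H G a b → G b c → Walk H G a c
    snoc here        g = there g here
    snoc (there h w) g = there h (snoc w g)

    reverse : ∀ {a b} → Walk H G a b → Walk H G b a
    reverse here        = here
    reverse (there g w) = snoc (reverse w) (G-sym g)

    _++_ : ∀ {a b c} → Walk H G a b → Walk H G b c → Walk H G a c
    here      ++ w = w
    there g v ++ w = there g (v ++ w)

module TourFacts (H : Hypergraph) (ρ : Node H → Node H → Node H) (rib : IsRibbon H ρ)
  (T : Fin (Hypergraph.nV H) → Fin (Hypergraph.nE H) → Bool) (b₀ b₁ : Node H)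
  (b₀b₁ : Adj H b₀ b₁) where
  open Graph H
  open Tour H T ρ b₀ b₁

  -- ρ x is a cyclic permutation of the neighbours of x, hence injective on them
  ρ-injective : ∀ x {y z} → Adj H x y → Adj H x z → ρ x y ≡ ρ x z → y ≡ z
  ρ-injective x {y} {z} xy xz = periodic-injective (ρ x) (proj₁ (period xy)) (proj₁ (period xz))
    (proj₂ (period xy)) (proj₂ (period xz))
    where
    period : ∀ {w} → Adj H x w → ∃ λ k → iter (ρ x) (suc k) w ≡ w
    period {w} xw with proj₂ rib x (ρ x w) w (proj₁ rib x w xw) xw
    ... | k , back = k , trans (iter-suc (ρ x) k w) back

  stepCases : ∀ x y → (lift H T x y ≡ true × step H T ρ (x , y) ≡ (y , ρ y x))
                    ⊎ (lift H T x y ≡ false × step H T ρ (x , y) ≡ (x , ρ x y))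
  stepCases x y with lift H T x y
  ... | true  = inj₁ (refl , refl)
  ... | false = inj₂ (refl , refl)

  IsEdgeState : State → Set
  IsEdgeState (x , y) = Adj H x y

  step-edge : ∀ P → IsEdgeState P → IsEdgeState (step H T ρ P)
  step-edge (x , y) xy with stepCases x y
  ... | inj₁ (_ , eq) = subst IsEdgeState (sym eq) (proj₁ rib y x (adj-sym {x} {y} xy))
  ... | inj₂ (_ , eq) = subst IsEdgeState (sym eq) (proj₁ rib x y xy)

  tour-edge : ∀ n → IsEdgeState (tourAt n)
  tour-edge zero    = b₀b₁
  tour-edge (suc n) = step-edge (tourAt n) (tour-edge n)

  pivot-injective : ∀ {c c' w w'} → Adj H c w → Adj H c' w' → (c , ρ c w) ≡ (c' , ρ c' w') → c ≡ c' × w ≡ w'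
  pivot-injective {c} cw c'w' eq with cong proj₁ eq
  ... | refl = refl , ρ-injective c cw c'w' (cong proj₂ eq)

  tree-status-sym : ∀ {x y} → lift H T x y ≡ true → lift H T y x ≡ false → ⊥
  tree-status-sym {x} {y} t t' with trans (sym t) (trans (lift-sym T x y) t')
  ... | ()

  step-injective : ∀ P Q → IsEdgeState P → IsEdgeState Q → step H T ρ P ≡ step H T ρ Q → P ≡ Q
  step-injective (x , y) (x' , y') xy x'y' eq with stepCases x y | stepCases x' y'
  ... | inj₁ (_ , s) | inj₁ (_ , s')
      with pivot-injective (adj-sym {x} {y} xy) (adj-sym {x'} {y'} x'y') (trans (sym s) (trans eq s'))
  ...   | refl , refl = refl
  step-injective (x , y) (x' , y') xy x'y' eq | inj₂ (_ , s) | inj₂ (_ , s')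
      with pivot-injective xy x'y' (trans (sym s) (trans eq s'))
  ...   | refl , refl = refl
  step-injective (x , y) (x' , y') xy x'y' eq | inj₁ (t , s) | inj₂ (t' , s')
      with pivot-injective (adj-sym {x} {y} xy) x'y' (trans (sym s) (trans eq s'))
  ...   | refl , refl = ⊥-elim (tree-status-sym {x} {y} t t')
  step-injective (x , y) (x' , y') xy x'y' eq | inj₂ (t , s) | inj₁ (t' , s')
      with pivot-injective xy (adj-sym {x'} {y'} x'y') (trans (sym s) (trans eq s'))
  ...   | refl , refl = ⊥-elim (tree-status-sym {y} {x} t' t)

  start : State
  start = (b₀ , b₁)

  shift : ∀ a d → tourAt (a + d) ≡ tourAt a → tourAt d ≡ start
  shift zero    d eq = eq
  shift (suc a) d eq = shift a d (step-injective _ _ (tour-edge (a + d)) (tour-edge a) eq)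

  repeat⇒return : ∀ {i j} → i < j → tourAt i ≡ tourAt j → ∃ λ p → 1 ≤ p × p ≤ j × tourAt p ≡ start
  repeat⇒return {i} {j} i<j eq with m≤n⇒∃[o]m+o≡n i<j
  ... | o , i+1+o≡j = suc o , s≤s z≤n , subst (suc o ≤_) i+suc-o≡j (m≤n+m (suc o) i) ,
                      shift i (suc o) (subst (λ k → tourAt k ≡ tourAt i) (sym i+suc-o≡j) (sym eq))
    where
    i+suc-o≡j : i + suc o ≡ j
    i+suc-o≡j = trans (+-suc i o) i+1+o≡j

  InTour-mono : ∀ {k j} → k ≤ j → InTour j → InTour k
  InTour-mono k≤j inTour m 1≤m m≤k = inTour m 1≤m (≤-trans m≤k k≤j)

  tour-distinct : ∀ {i j} → i < j → InTour j → tourAt i ≡ tourAt j → ⊥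
  tour-distinct i<j inTour eq with repeat⇒return i<j eq
  ... | p , 1≤p , p≤j , back = inTour p 1≤p p≤j back

  -- by the pigeonhole principle the tour returns to its start
  returns : ∃ λ p → 1 ≤ p × tourAt p ≡ start
  returns with Finₚ.pigeonhole (n<1+n stateCount) (λ i → encode (tourAt (Fin.toℕ i)))
  ... | i , j , i<j , eq with repeat⇒return i<j (encode-injective _ _ eq)
  ...   | p , 1≤p , _ , back = p , 1≤p , back

  firstReturn : ∃ λ q → 1 ≤ q × tourAt q ≡ start × (∀ {k} → k < q → InTour k)
  firstReturn with leastWitness isReturn? (proj₂ returns)
    where
    isReturn? : ∀ p → Dec (1 ≤ p × tourAt p ≡ start)
    isReturn? p = (1 ≤? p) ×-dec (tourAt p ≟S start)
  ... | q , (1≤q , back) , earlier =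
        q , 1≤q , back , λ k<q m 1≤m m≤k back' → earlier (≤-<-trans m≤k k<q) (1≤m , back')

module Crossing (H : Hypergraph) (ρ : Node H → Node H → Node H) (rib : IsRibbon H ρ)
  (b₀ b₁ : Node H) (b₀b₁ : Adj H b₀ b₁)
  (T : Fin (Hypergraph.nV H) → Fin (Hypergraph.nE H) → Bool)
  (J : Tour.IsVCutJaeger H T ρ b₀ b₁)
  (vε : Fin (Hypergraph.nV H)) (eε : Fin (Hypergraph.nE H)) (ε∈T : T vε eε ≡ true) where
  open Graph H
  open Tour H T ρ b₀ b₁
  open TourFacts H ρ rib T b₀ b₁ b₀b₁

  ε : BEdge H
  ε = (vε , eε)

  TM : Node H → Node H → Set
  TM = TMinusAdj H T ε

  TM-sym : ∀ {x y} → TM x y → TM y x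
  TM-sym {x} {y} (t , n₁ , n₂) =
    trans (lift-sym T y x) t , (λ { (a , b) → n₂ (b , a) }) , (λ { (a , b) → n₁ (b , a) })

  open Walks TM TM-sym

  Base : Node H → Set
  Base = InBaseComp H T ε b₀

  base-walk : ∀ {a b} → Base a → Base b → Walk H TM a b
  base-walk ba bb = reverse ba ++ bb

  OnEps : State → Set
  OnEps (x , y) = (x ≡ inj₁ vε × y ≡ inj₂ eε) ⊎ (x ≡ inj₂ eε × y ≡ inj₁ vε)

  onEps? : ∀ P → Dec (OnEps P)
  onEps? (x , y) = ((x ≟N inj₁ vε) ×-dec (y ≟N inj₂ eε)) ⊎-dec ((x ≟N inj₂ eε) ×-dec (y ≟N inj₁ vε))

  tree-edge-off-ε : ∀ x y → TAdj H T x y → ¬ OnEps (x , y) → TM x y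
  tree-edge-off-ε x y t off = t , (λ p → off (inj₁ p)) , (λ p → off (inj₂ p))

  -- unless some node lies outside, the base component cannot contain both ends of ε:
  -- otherwise it would absorb every edge of the connected tree T
  ends-apart : ∀ {z} → ¬ Base z → Base (inj₁ vε) → Base (inj₂ eε) → ⊥
  ends-apart {z} outside bv be = outside (extend (proj₁ (proj₂ (proj₁ J)) b₀ z) here)
    where
    extend : ∀ {a b} → Walk H (TAdj H T) a b → Base a → Base b
    extend here ba = ba
    extend (there {x} {y} t w) ba with onEps? (x , y)
    ... | yes (inj₁ (_ , refl)) = extend w be
    ... | yes (inj₂ (_ , refl)) = extend w bv
    ... | no off = extend w (snoc ba (tree-edge-off-ε x y t off))

  off-ε-step : ∀ P → ¬ OnEps P →
    (Base (proj₁ P) → Base (proj₁ (step H T ρ P))) × (Base (proj₁ (step H T ρ P)) → Base (proj₁ P))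
  off-ε-step (x , y) off with stepCases x y
  ... | inj₁ (t , eq) rewrite eq =
        (λ bx → snoc bx (tree-edge-off-ε x y t off)) , (λ by → snoc by (TM-sym (tree-edge-off-ε x y t off)))
  ... | inj₂ (_ , eq) rewrite eq = (λ bx → bx) , (λ bx → bx)

  ε-in-T : ∀ {x y} → OnEps (x , y) → lift H T x y ≡ true
  ε-in-T (inj₁ (refl , refl)) = ε∈T
  ε-in-T (inj₂ (refl , refl)) = ε∈T

  ε-step : ∀ P → OnEps P → proj₁ (step H T ρ P) ≡ proj₂ P
  ε-step (x , y) on with stepCases x y
  ... | inj₁ (_ , eq) = cong proj₁ eq
  ... | inj₂ (off , _) with trans (sym off) (ε-in-T on)
  ...   | ()

  here-at : ℕ → Node H
  here-at k = proj₁ (tourAt k)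

  Exit : ℕ → Set
  Exit s = OnEps (tourAt s) × Base (here-at s)

  Entry : ℕ → Set
  Entry s = OnEps (tourAt s) × Base (proj₂ (tourAt s))

  leaves : ∀ {i j} → i ≤ j → Base (here-at i) → ¬ Base (here-at j) → ∃ λ s → i ≤ s × s < j × Exit s
  leaves i≤j bi outside with persists (λ k → Base (here-at k)) Exit move (≤⇒≤′ i≤j) bi
    where
    move : ∀ k → Base (here-at k) → Base (here-at (suc k)) ⊎ Exit k
    move k bk with onEps? (tourAt k)
    ... | yes on  = inj₂ (on , bk)
    ... | no off  = inj₁ (proj₁ (off-ε-step (tourAt k) off) bk)
  ... | inj₁ bj   = ⊥-elim (outside bj)
  ... | inj₂ exit = exit

  enters : ∀ {i j} → i ≤ j → ¬ Base (here-at i) → Base (here-at j) → ∃ λ s → i ≤ s × s < j × Entry s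
  enters i≤j outside bj with recedes (λ k → Base (here-at k)) Entry move (≤⇒≤′ i≤j) bj
    where
    move : ∀ k → Base (here-at (suc k)) → Base (here-at k) ⊎ Entry k
    move k bk+1 with onEps? (tourAt k)
    ... | yes on = inj₂ (on , subst Base (ε-step (tourAt k) on) bk+1)
    ... | no off = inj₁ (proj₂ (off-ε-step (tourAt k) off) bk+1)
  ... | inj₁ bi    = ⊥-elim (outside bi)
  ... | inj₂ entry = entry

  -- all exits are the same state, since only one end of ε is in the base component
  exit-state : ∀ {z} s s' → ¬ Base z → Exit s → Exit s' → tourAt s ≡ tourAt s'
  exit-state _ _ _ (inj₁ (p , q) , _) (inj₁ (p' , q') , _) = cong₂ _,_ (trans p (sym p')) (trans q (sym q'))
  exit-state _ _ _ (inj₂ (p , q) , _) (inj₂ (p' , q') , _) = cong₂ _,_ (trans p (sym p')) (trans q (sym q'))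
  exit-state _ _ outside (inj₁ (p , _) , b) (inj₂ (p' , _) , b') =
    ⊥-elim (ends-apart outside (subst Base p b) (subst Base p' b'))
  exit-state _ _ outside (inj₂ (p , _) , b) (inj₁ (p' , _) , b') =
    ⊥-elim (ends-apart outside (subst Base p' b') (subst Base p b))

  no-second-exit : ∀ {z j} s s' → ¬ Base z → s < s' → s' ≤ j → InTour j → Exit s → Exit s' → ⊥
  no-second-exit s s' outside s<s' s'≤j inTour exit exit' =
    tour-distinct s<s' (InTour-mono s'≤j inTour) (exit-state s s' outside exit exit')

  exit-from-violet : ∀ s → ¬ Base (inj₂ eε) → Exit s → tourAt s ≡ violetState ε
  exit-from-violet _ _       (inj₁ (p , q) , _) = cong₂ _,_ p q
  exit-from-violet _ outside (inj₂ (p , _) , b) = ⊥-elim (outside (subst Base p b))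

  entry-to-emerald : ∀ s → ¬ Base (inj₁ vε) → Entry s → tourAt s ≡ violetState ε
  entry-to-emerald _ _       (inj₁ (p , q) , _) = cong₂ _,_ p q
  entry-to-emerald _ outside (inj₂ (_ , q) , b) = ⊥-elim (outside (subst Base q b))

  cut-emerald-outside : ∀ {v e} → InFundCut H T ε (v , e) → Base (inj₁ v) → ¬ Base (inj₂ e)
  cut-emerald-outside cut bv be = proj₂ cut (base-walk bv be)

  cut-violet-outside : ∀ {v e} → InFundCut H T ε (v , e) → Base (inj₂ e) → ¬ Base (inj₁ v)
  cut-violet-outside cut be bv = proj₂ cut (base-walk bv be)

  -- a cut edge other than ε is a non-edge of T (a tree edge would join its ends in T - ε),
  -- so by the V-cut property its violet visit precedes its emerald visit
  cut-visits : ∀ {v e} → InFundCut H T ε (v , e) → ¬ (v , e) ≡ ε →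
    Precedes (inj₁ v , inj₂ e) (inj₂ e , inj₁ v)
  cut-visits {v} {e} cut ≢ε = proj₂ J v e (proj₁ cut) non-edge
    where
    non-edge : T v e ≡ false
    non-edge with T v e in eq
    ... | false = refl
    ... | true  = ⊥-elim (proj₂ cut (there tree-edge here))
      where
      tree-edge : TM (inj₁ v) (inj₂ e)
      tree-edge = eq , (λ { (a , b) → ≢ε (violetState-injective (cong₂ _,_ a b)) }) , (λ { (() , _) })

  -- if eε is in the base component and the tour is outside it at time j (at e),
  -- then before returning to b₀ it re-enters through the violet visit of ε
  before-entry : ∀ {v e i j} → Base (inj₂ eε) → ¬ Base (inj₂ e) → i < j → InTour j →
    tourAt i ≡ violetState (v , e) → tourAt j ≡ (inj₂ e , inj₁ v) → (v , e) <TV ε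
  before-entry {i = i} {j} be outside i<j inTour ti tj with firstReturn
  ... | q , 1≤q , back , inTour<q with q ≤? j
  ...   | yes q≤j = ⊥-elim (inTour q 1≤q q≤j back)
  ...   | no q≰j with enters (<⇒≤ (≰⇒> q≰j)) (λ bj → outside (subst Base (cong proj₁ tj) bj))
                      (subst Base (sym (cong proj₁ back)) here)
  ...     | r , j≤r , r<q , entry =
            i , r , <-≤-trans i<j j≤r , inTour<q r<q , ti ,
            entry-to-emerald r (λ bv → ends-apart outside bv be) entry

  record Traversal (v : Fin (Hypergraph.nV H)) (e : Fin (Hypergraph.nE H)) : Set where
    field
      out exit back : ℕ
      out≤exit      : out ≤ exit
      exit<back     : exit < back
      back-in-tour  : InTour back
      at-out        : tourAt out ≡ violetState (v , e)
      at-back       : tourAt back ≡ (inj₂ e , inj₁ v)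
      exits         : Exit exit

  -- the traversal exists by the V-cut property and the change of component from v to e
  traversal : ∀ {v e} → InFundCut H T ε (v , e) → ¬ (v , e) ≡ ε → Base (inj₁ v) → Traversal v e
  traversal cut ≢ε bv with cut-visits cut ≢ε
  ... | i , j , i<j , inTour , ti , tj
      with leaves (<⇒≤ i<j) (subst Base (sym (cong proj₁ ti)) bv)
                  (λ bj → cut-emerald-outside cut bv (subst Base (cong proj₁ tj) bj))
  ...   | s , i≤s , s<j , exit = record
          { out = i ; exit = s ; back = j ; out≤exit = i≤s ; exit<back = s<j
          ; back-in-tour = inTour ; at-out = ti ; at-back = tj ; exits = exit }

  visit-after-exit : ∀ {v e} → InFundCut H T ε (v , e) → ¬ (v , e) ≡ ε → Base (inj₂ e) →
    ∃ λ i → ∃ λ s → s < i × InTour i × tourAt i ≡ violetState (v , e) × Exit s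
  visit-after-exit cut ≢ε be with cut-visits cut ≢ε
  ... | i , j , i<j , inTour , ti , _
      with leaves z≤n here (λ bi → cut-violet-outside cut be (subst Base (cong proj₁ ti) bi))
  ...   | s , _ , s<i , exit = i , s , s<i , InTour-mono (<⇒≤ i<j) inTour , ti , exit

  module _ {v e} (cut : InFundCut H T ε (v , e)) (≢ε : ¬ (v , e) ≡ ε) (bv : Base (inj₁ v)) where
    open Traversal (traversal cut ≢ε bv)

    traversal-before-entry : Base (inj₂ eε) → (v , e) <TV ε
    traversal-before-entry be =
      before-entry be (cut-emerald-outside cut bv) (≤-<-trans out≤exit exit<back) back-in-tour at-out at-back

    -- (v , e) precedes ε: the exit is either the violet visit of ε or leads back into eε
    traversal-before-ε : (v , e) <TV ε
    traversal-before-ε with exits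
    ... | inj₂ (p , _) , b = traversal-before-entry (subst Base p b)
    ... | inj₁ (p , q) , _ with m≤n⇒m<n∨m≡n out≤exit
    ...   | inj₁ out<exit = out , exit , out<exit , InTour-mono (<⇒≤ exit<back) back-in-tour , at-out , cong₂ _,_ p q
    ...   | inj₂ out≡exit =
            ⊥-elim (≢ε (violetState-injective (trans (sym at-out) (trans (cong tourAt out≡exit) (cong₂ _,_ p q)))))

    -- (v , e) precedes a cut edge (v₂ , e₂) ≠ ε with e₂ in the base component:
    -- the latter is visited after an exit, and the only exit lies in [out , back)
    traversal-before-cut : ∀ {v₂ e₂} → InFundCut H T ε (v₂ , e₂) → ¬ (v₂ , e₂) ≡ ε →
      Base (inj₂ e₂) → (v , e) <TV (v₂ , e₂)
    traversal-before-cut cut₂ ≢ε₂ be₂ with visit-after-exit cut₂ ≢ε₂ be₂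
    ... | i , s , s<i , inTour , ti , exit′ with <-cmp out i
    ...   | tri< out<i _ _ = out , i , out<i , inTour , at-out , ti
    ...   | tri≈ _ out≡i _ = ⊥-elim (cut-violet-outside cut₂ be₂
                               (subst Base (cong proj₁ (trans (sym at-out) (trans (cong tourAt out≡i) ti))) bv))
    ...   | tri> _ _ i<out = ⊥-elim (no-second-exit s exit (cut-violet-outside cut₂ be₂)
                               (<-≤-trans (<-trans s<i i<out) out≤exit) (<⇒≤ exit<back) back-in-tour exit′ exits)

  -- if ε itself has its violet end in the base component, the exit before the
  -- visit of a cut edge (v , e) ≠ ε with e in the base component is the visit of ε
  ε-before-cut : ∀ {v e} → ¬ Base (inj₂ eε) → InFundCut H T ε (v , e) → ¬ (v , e) ≡ ε → Base (inj₂ e) →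
    ε <TV (v , e)
  ε-before-cut outside cut ≢ε be with visit-after-exit cut ≢ε be
  ... | i , s , s<i , inTour , ti , exit = s , i , s<i , inTour , exit-from-violet s outside exit , ti

  cut-order : ∀ {v₁ e₁ v₂ e₂} → InFundCut H T ε (v₁ , e₁) → InFundCut H T ε (v₂ , e₂) →
    Base (inj₁ v₁) → Base (inj₂ e₂) → (v₁ , e₁) <TV (v₂ , e₂)
  cut-order {v₁} {e₁} {v₂} {e₂} cut₁ cut₂ bv₁ be₂ with (v₁ , e₁) ≟E ε | (v₂ , e₂) ≟E ε
  ... | yes refl | yes refl = ⊥-elim (cut-emerald-outside cut₁ bv₁ be₂)
  ... | yes refl | no ≢ε₂   = ε-before-cut (cut-emerald-outside cut₁ bv₁) cut₂ ≢ε₂ be₂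
  ... | no ≢ε₁   | yes refl = traversal-before-entry cut₁ ≢ε₁ bv₁ be₂
  ... | no ≢ε₁   | no ≢ε₂   = traversal-before-cut cut₁ ≢ε₁ bv₁ cut₂ ≢ε₂ be₂

  cut-before-ε : ∀ {v e} → InFundCut H T ε (v , e) → Base (inj₁ v) → (v , e) ≤TV ε
  cut-before-ε {v} {e} cut bv with (v , e) ≟E ε
  ... | yes same  = inj₁ same
  ... | no differ = inj₂ (traversal-before-ε cut differ bv)

lemma6p13 : (H : Hypergraph) → (ρ : Node H → Node H → Node H) → (b₀ b₁ : Node H) →
    Connected H → IsRibbon H ρ → Adj H b₀ b₁ →
    (T : Fin (Hypergraph.nV H) → Fin (Hypergraph.nE H) → Bool) →
    Tour.IsVCutJaeger H T ρ b₀ b₁ →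
    (ε ε₁ ε₂ : BEdge H) →
    T (proj₁ ε) (proj₂ ε) ≡ true →
    InFundCut H T ε ε₁ → InFundCut H T ε ε₂ →
    InBaseComp H T ε b₀ (inj₁ (proj₁ ε₁)) →
    InBaseComp H T ε b₀ (inj₂ (proj₂ ε₂)) →
    Tour._<TV_ H T ρ b₀ b₁ ε₁ ε₂ × Tour._≤TV_ H T ρ b₀ b₁ ε₁ ε
lemma6p13 H ρ b₀ b₁ _ rib b₀b₁ T J (vε , eε) ε₁ ε₂ ε∈T cut₁ cut₂ bv₁ be₂ =
  cut-order cut₁ cut₂ bv₁ be₂ , cut-before-ε cut₁ bv₁
  where open Crossing H ρ rib b₀ b₁ b₀b₁ T J vε eε ε∈T
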